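{- Let $r\ge 3$ and $k\ge 2$ be integers. In the hypergraphical clustering game with non-monochromatic seeking players and $k$ colors, the price of anarchy over the family $\mathbb{H}_{\ge r}$ of all $r$-minimal hypergraphs satisfies $$PoA(\mathbb{H}_{\ge r},k)=1+\frac{1}{(k-1)r}.$$
   Context: A hypergraph is a pair $H=(V,\mathcal{E})$ with $V$ a finite set of vertices (players) and $\mathcal{E}$ a collection of non-empty subsets of $V$ (hyperedges). $H$ is $r$-minimal if $|e|\ge r$ for all $e\in\mathcal{E}$; $\mathbb{H}_{\ge r}$ denotes the family of all $r$-minimal hypergraphs. A $k$-coloring is a function $c:V\to[k]=\{1,\dots,k\}$; $\mathcal{C}(k)$ is the set of all $k$-colorings, and for $e\in\mathcal{E}$, $c(e)\subseteq[k]$ is the set of colors of vertices of $e$. Let $\mathcal{E}(v)=\{e\in\mathcal{E}: v\in e\}$. A non-monochromatic seeking player $v$ has utility $u_v(c)=|\{e\in\mathcal{E}(v): |c(e)|>1\}|$. The social welfare is $SW(c)=\sum_{v\in V}u_v(c)$. A coloring $c$ is a (pure) Nash equilibrium if $u_v(c)\ge u_v(c_{ -v},i)$ for all $v\in V$, $i\in[k]$, where $(c_{ -v},i)$ is $c$ with the color of $v$ changed to $i$. Let $O(H,k)=\max\{SW(c): c\in\mathcal{C}(k)\}$, $NE(H,k)=\min\{SW(c): c\in\mathcal{C}(k)\text{ a Nash equilibrium}\}$, and for a family $\mathcal{H}$ of hypergraphs $PoA(\mathcal{H},k)=\sup_{H\in\mathcal{H}} O(H,k)/NE(H,k)$. 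-}

module Defs where

open import Data.Nat using (ℕ; zero; suc; _≤_; _<_; _≤?_; _<?_; _⊔_; _⊓_)
open import Data.Fin using (Fin; zero; suc; _≟_)
open import Data.Fin.Subset using (Subset; _∈_; ∣_∣)
open import Data.Fin.Subset.Properties using (_∈?_)
open import Data.Fin.Properties using (any?; all?)
open import Data.List using (List; []; _∷_; length; filter; map; foldr; allFin; concatMap)
open import Data.List.Relation.Unary.All using (All)
open import Data.Vec using (tabulate)
open import Data.Nat.ListAction using (sum)
open import Data.Bool using (Bool; if_then_else_)
open import Data.Product using (_×_)
open import Relation.Nullary using (Dec; does)
open import Relation.Nullary.Decidable using (_×-dec_)
open import Data.Integer using (+_)
open import Data.Rational using (ℚ; _/_; 0ℚ)

-- A hypergraph on the vertex set V = Fin n: a (finite) collection of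
-- hyperedges, each a subset of V.  (Repeated hyperedges are allowed.)
Hypergraph : ℕ → Set
Hypergraph n = List (Subset n)

IsHypergraph : ∀ {n} → Hypergraph n → Set
IsHypergraph H = All (λ e → 1 ≤ ∣ e ∣) H

RMinimal : ℕ → ∀ {n} → Hypergraph n → Set
RMinimal r H = All (λ e → r ≤ ∣ e ∣) H

Coloring : ℕ → ℕ → Set
Coloring n k = Fin n → Fin k

colorsOf : ∀ {n k} → Coloring n k → Subset n → Subset k
colorsOf {n} c e = tabulate (λ i → does (any? (λ v → (v ∈? e) ×-dec (c v ≟ i))))

utility : ∀ {n k} → Hypergraph n → Coloring n k → Fin n → ℕ
utility H c v = length (filter (λ e → (v ∈? e) ×-dec (1 <? ∣ colorsOf c e ∣)) H)

SW : ∀ {n k} → Hypergraph n → Coloring n k → ℕ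
SW {n} H c = sum (map (utility H c) (allFin n))

recolor : ∀ {n k} → Coloring n k → Fin n → Fin k → Coloring n k
recolor c v i w = if does (w ≟ v) then i else c w

IsNash : ∀ {n k} → Hypergraph n → Coloring n k → Set
IsNash {n} {k} H c = (v : Fin n) (i : Fin k) → utility H (recolor c v i) v ≤ utility H c v

isNash? : ∀ {n k} (H : Hypergraph n) (c : Coloring n k) → Dec (IsNash H c)
isNash? H c = all? (λ v → all? (λ i → utility H (recolor c v i) v ≤? utility H c v))

allColorings : ∀ n k → List (Coloring n k)
allColorings zero    k = (λ ()) ∷ []
allColorings (suc n) k =
  concatMap (λ c → map (λ i → λ { zero → i ; (suc j) → c j }) (allFin k)) (allColorings n k)

maxL : List ℕ → ℕ
maxL = foldr _⊔_ 0

minL : List ℕ → ℕ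
minL []           = 0
minL (x ∷ [])     = x
minL (x ∷ y ∷ xs) = x ⊓ minL (y ∷ xs)

Opt : ∀ {n} → Hypergraph n → (k : ℕ) → ℕ
Opt {n} H k = maxL (map (SW H) (allColorings n k))

NE : ∀ {n} → Hypergraph n → (k : ℕ) → ℕ
NE {n} H k = minL (map (SW H) (filter (isNash? H) (allColorings n k)))

-- a / d as a rational (only used with d ≠ 0; convention a / 0 = 0)
frac : ℕ → ℕ → ℚ
frac a zero    = 0ℚ
frac a (suc d) = (+ a) / suc d

-- Fix a Nash equilibrium c. Let S = SW(c), let N be the number of its non-monochromatic
-- edges and W the total size of its monochromatic ones. Any colouring c′ has welfare at most
-- the total size of all edges, S + W, and r-minimality gives r N ≤ S. Stability gives the
-- missing link (k − 1) W ≤ N: if v lies in m monochromatic edges and switches to one of the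
-- k − 1 other colours i, it makes those m edges non-monochromatic (edges have ≥ 2 vertices),
-- so it must make at least m non-monochromatic edges monochromatic; and an edge with ≥ 3
-- vertices becomes monochromatic under at most one such switch (v, i). Hence
-- SW(c′) (k − 1) r ≤ S (k − 1) r + W (k − 1) r ≤ S (k − 1) r + S.
--
-- The bound is attained on the k × r grid with the edges "row 0" and, for every row i ≠ 0
-- and column j, "cell (0, j) together with row i minus its cell in column j". Colouring by
-- rows is an equilibrium in which only row 0 is monochromatic, welfare r (k − 1) r, while a
-- small perturbation of it makes every edge non-monochromatic, welfare r + r (k − 1) r.

module Submission where

open import Defs

open import Data.Bool using (true; false; if_then_else_)
open import Data.Empty using (⊥-elim)
open import Data.Fin using (Fin; zero; suc; _≟_; punchIn; _↑ˡ_; _↑ʳ_; combine; remQuot)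
import Data.Fin.Properties as Finₚ
open Finₚ using (suc-injective; punchInᵢ≢i; any?; remQuot-combine; combine-remQuot)
open import Data.Fin.Subset using (Subset; _∈_; ∣_∣; inside; outside)
open import Data.Fin.Subset.Properties using (_∈?_)
import Data.Integer as ℤ
open import Data.Integer.Properties using (pos-*)
open import Data.List using ([]; _∷_; map; length; filter; tabulate; allFin)
open import Data.List.Membership.Propositional using (lose) renaming (_∈_ to _∈ₗ_)
open import Data.List.Membership.Propositional.Properties
  using (∈-map⁺; ∈-map⁻; ∈-filter⁺; ∈-filter⁻; ∈-concatMap⁺; ∈-allFin)
open import Data.List.Properties using (map-tabulate; map-cong; map-cong-local)
open import Data.List.Relation.Unary.All as All using (All; []; _∷_)
open import Data.List.Relation.Unary.All.Properties using (tabulate⁺)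
open import Data.List.Relation.Unary.Any using (here; there)
open import Data.Nat using (ℕ; zero; suc; _+_; _*_; _∸_; _≤_; _<_; _<?_; z≤n; s≤s)
import Data.Nat.ListAction as List
open import Data.Nat.Properties hiding (_≟_; suc-injective)
open import Data.Nat.Solver using (module +-*-Solver)
open +-*-Solver using (solve; _:+_; _:*_; con; _:=_)
open import Algebra.Properties.CommutativeSemigroup +-commutativeSemigroup using (interchange)
open import Algebra.Properties.Semiring.Sum +-*-semiring
  using (sum; sum-syntax; sum-cong-≗; ∑-distrib-+; ∑-comm; *-distribˡ-sum; *-distribʳ-sum; sum-remove)
open import Data.Product using (Σ; ∃; ∃₂; _×_; _,_; proj₁; proj₂)
open import Data.Rational using (ℚ; 0ℚ; 1ℚ)
  renaming (_≤_ to _≤ℚ_; _<_ to _<ℚ_; _+_ to _+ℚ_; _-_ to _-ℚ_)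
import Data.Rational.Properties as ℚₚ
open import Data.Rational.Unnormalised using (mkℚᵘ; *≤*; *≡*)
open import Data.Rational.Unnormalised.Properties
  using (≤-respˡ-≃; ≤-respʳ-≃; ≃-sym; ≃-trans; ≃-refl; +-cong)
open import Data.Sum using (_⊎_; inj₁; inj₂)
import Data.Vec as Vec
open Vec using ([]; _∷_)
open import Data.Vec.Properties using (lookup∘tabulate; []=⇒lookup; lookup⇒[]=)
open import Function using (_∘_; id; _⇔_; mk⇔; Equivalence)
open import Relation.Binary.PropositionalEquality
open import Relation.Nullary using (Dec; yes; no; does; ¬_; contradiction)
open import Relation.Nullary.Decidable using (_×-dec_; ¬?; does-⇔; dec-true; dec-false; decidable-stable)

⟦_⟧ : ∀ {P : Set} → Dec P → ℕ
⟦ P? ⟧ = if does P? then 1 else 0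

⟦⟧≤1 : ∀ {P : Set} (P? : Dec P) → ⟦ P? ⟧ ≤ 1
⟦⟧≤1 (yes _) = s≤s z≤n
⟦⟧≤1 (no _)  = z≤n

⟦⟧-yes : ∀ {P : Set} (P? : Dec P) → P → ⟦ P? ⟧ ≡ 1
⟦⟧-yes (yes _) _ = refl
⟦⟧-yes (no ¬p) p = ⊥-elim (¬p p)

⟦⟧-no : ∀ {P : Set} (P? : Dec P) → ¬ P → ⟦ P? ⟧ ≡ 0
⟦⟧-no (yes p) ¬p = ⊥-elim (¬p p)
⟦⟧-no (no _)  _  = refl

⟦⟧>0⇒ : ∀ {P : Set} (P? : Dec P) → 0 < ⟦ P? ⟧ → P
⟦⟧>0⇒ (yes p) _ = p

⟦×-dec⟧ : ∀ {P Q : Set} (P? : Dec P) (Q? : Dec Q) → ⟦ P? ×-dec Q? ⟧ ≡ ⟦ P? ⟧ * ⟦ Q? ⟧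
⟦×-dec⟧ (yes _) Q? = sym (+-identityʳ ⟦ Q? ⟧)
⟦×-dec⟧ (no _)  Q? = refl

⟦⟧+⟦¬?⟧ : ∀ {P : Set} (P? : Dec P) → ⟦ P? ⟧ + ⟦ ¬? P? ⟧ ≡ 1
⟦⟧+⟦¬?⟧ (yes _) = refl
⟦⟧+⟦¬?⟧ (no _)  = refl

⟦⟧-cong : ∀ {P Q : Set} → P ⇔ Q → (P? : Dec P) (Q? : Dec Q) → ⟦ P? ⟧ ≡ ⟦ Q? ⟧
⟦⟧-cong P⇔Q P? Q? = cong (λ b → if b then 1 else 0) (does-⇔ P⇔Q P? Q?)

⟦⟧≤⟦⟧*⟦⟧+⟦⟧ : ∀ {A B C : Set} (A? : Dec A) (B? : Dec B) (C? : Dec C) → (A → ¬ B → C) →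
              ⟦ A? ⟧ ≤ ⟦ A? ⟧ * ⟦ B? ⟧ + ⟦ C? ⟧
⟦⟧≤⟦⟧*⟦⟧+⟦⟧ (no _)  _       _       _       = z≤n
⟦⟧≤⟦⟧*⟦⟧+⟦⟧ (yes _) (yes _) _       _       = s≤s z≤n
⟦⟧≤⟦⟧*⟦⟧+⟦⟧ (yes _) (no _)  (yes _) _       = s≤s z≤n
⟦⟧≤⟦⟧*⟦⟧+⟦⟧ (yes a) (no ¬b) (no ¬c) a∧¬b⇒c = ⊥-elim (¬c (a∧¬b⇒c a ¬b))

⟦⟧*⟦⟧+-≤ : ∀ {A B : Set} (A? : Dec A) (B? : Dec B) {x y} → x ≤ y → (A → B → x < y) →
           ⟦ A? ⟧ * ⟦ B? ⟧ + x ≤ y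
⟦⟧*⟦⟧+-≤ (yes a) (yes b) _   a∧b⇒x<y = a∧b⇒x<y a b
⟦⟧*⟦⟧+-≤ (yes _) (no _)  x≤y _       = x≤y
⟦⟧*⟦⟧+-≤ (no _)  _       x≤y _       = x≤y

∑-const : ∀ n m → ∑[ i < n ] m ≡ n * m
∑-const zero    m = refl
∑-const (suc n) m = cong (m +_) (∑-const n m)

∑-zero : ∀ {n} (f : Fin n → ℕ) → (∀ i → f i ≡ 0) → sum f ≡ 0
∑-zero {n} f f≡0 = trans (sum-cong-≗ f≡0) (trans (∑-const n 0) (*-zeroʳ n))

∑-mono-≤ : ∀ {n} {f g : Fin n → ℕ} → (∀ i → f i ≤ g i) → sum f ≤ sum g
∑-mono-≤ {zero}  f≤g = z≤n
∑-mono-≤ {suc n} f≤g = +-mono-≤ (f≤g zero) (∑-mono-≤ (f≤g ∘ suc))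

∑-mono-< : ∀ {n} {f g : Fin n → ℕ} → (∀ i → f i ≤ g i) → ∀ j → f j < g j → sum f < sum g
∑-mono-< f≤g zero    fj<gj = +-mono-<-≤ fj<gj (∑-mono-≤ (f≤g ∘ suc))
∑-mono-< f≤g (suc j) fj<gj = +-mono-≤-< (f≤g zero) (∑-mono-< (f≤g ∘ suc) j fj<gj)

≤-∑ : ∀ {n} (f : Fin n → ℕ) i → f i ≤ sum f
≤-∑ f zero    = m≤m+n (f zero) _
≤-∑ f (suc i) = ≤-trans (≤-∑ (f ∘ suc) i) (m≤n+m _ (f zero))

∑>0⇒∃ : ∀ {n} (f : Fin n → ℕ) → 0 < sum f → ∃ λ i → 0 < f i
∑>0⇒∃ {suc n} f ∑f>0 with f zero in eq
... | suc _ = zero , subst (0 <_) (sym eq) (s≤s z≤n)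
... | zero  = let i , fi>0 = ∑>0⇒∃ (f ∘ suc) ∑f>0 in suc i , fi>0

two⇒∑>1 : ∀ {n} (f : Fin n → ℕ) {i j} → i ≢ j → 0 < f i → 0 < f j → 1 < sum f
two⇒∑>1 f {zero}  {zero}  i≢j _    _    = ⊥-elim (i≢j refl)
two⇒∑>1 f {zero}  {suc j} _   fi>0 fj>0 = +-mono-≤ fi>0 (≤-trans fj>0 (≤-∑ (f ∘ suc) j))
two⇒∑>1 f {suc i} {zero}  _   fi>0 fj>0 =
  subst (1 <_) (+-comm _ (f zero)) (+-mono-≤ (≤-trans fi>0 (≤-∑ (f ∘ suc) i)) fj>0)
two⇒∑>1 f {suc i} {suc j} i≢j fi>0 fj>0 =
  ≤-trans (two⇒∑>1 (f ∘ suc) (i≢j ∘ cong suc) fi>0 fj>0) (m≤n+m _ (f zero))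

∑>1⇒two : ∀ {n} (f : Fin n → ℕ) → (∀ i → f i ≤ 1) → 1 < sum f →
          ∃₂ λ i j → i ≢ j × 0 < f i × 0 < f j
∑>1⇒two {suc n} f f≤1 ∑f>1 with f zero in eq
... | zero  = let i , j , i≢j , fi>0 , fj>0 = ∑>1⇒two (f ∘ suc) (f≤1 ∘ suc) ∑f>1
              in suc i , suc j , i≢j ∘ suc-injective , fi>0 , fj>0
... | suc m = let j , fj>0 = ∑>0⇒∃ (f ∘ suc) tail>0
              in zero , suc j , (λ ()) , subst (0 <_) (sym eq) (s≤s z≤n) , fj>0
  where
  m≡0 : m ≡ 0
  m≡0 = n≤0⇒n≡0 (≤-pred (subst (_≤ 1) eq (f≤1 zero)))
  tail>0 : 0 < sum (f ∘ suc)
  tail>0 = +-cancelˡ-< 1 0 _ (subst (λ t → 1 < suc t + sum (f ∘ suc)) m≡0 ∑f>1)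

∑-≤1 : ∀ {n} (f : Fin n → ℕ) → (∀ i → f i ≤ 1) → (∀ i j → 0 < f i → 0 < f j → i ≡ j) →
       sum f ≤ 1
∑-≤1 f f≤1 unique with 1 <? sum f
... | no  ∑f≯1 = ≮⇒≥ ∑f≯1
... | yes ∑f>1 = let i , j , i≢j , fi>0 , fj>0 = ∑>1⇒two f f≤1 ∑f>1
                 in ⊥-elim (i≢j (unique i j fi>0 fj>0))

∑∑-≤1 : ∀ {m l} (f : Fin m → Fin l → ℕ) → (∀ a b → f a b ≤ 1) →
        (∀ {a b a′ b′} → 0 < f a b → 0 < f a′ b′ → a ≡ a′ × b ≡ b′) →
        ∑[ a < m ] ∑[ b < l ] f a b ≤ 1
∑∑-≤1 f f≤1 unique = ∑-≤1 _ row≤1 λ a a′ row>0 row′>0 →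
  let b , fab>0 = ∑>0⇒∃ (f a) row>0 ; b′ , fab′>0 = ∑>0⇒∃ (f a′) row′>0
  in proj₁ (unique fab>0 fab′>0)
  where
  row≤1 : ∀ a → ∑[ b < _ ] f a b ≤ 1
  row≤1 a = ∑-≤1 (f a) (f≤1 a) λ b b′ fab>0 fab′>0 → proj₂ (unique fab>0 fab′>0)

∑-except : ∀ {k} (f : Fin k → ℕ) (a : Fin k) m → (∀ i → i ≢ a → m ≤ f i) → (k ∸ 1) * m ≤ sum f
∑-except {suc k} f a m m≤f = begin
  k * m                             ≡⟨ ∑-const k m ⟨
  ∑[ j < k ] m                      ≤⟨ ∑-mono-≤ (λ j → m≤f (punchIn a j) (punchInᵢ≢i a j)) ⟩
  ∑[ j < k ] f (punchIn a j)        ≤⟨ m≤n+m _ (f a) ⟩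
  f a + ∑[ j < k ] f (punchIn a j)  ≡⟨ sum-remove f ⟨
  sum f                             ∎
  where open ≤-Reasoning

∑⟦≟⟧ : ∀ {n} (a : Fin n) → ∑[ x < n ] ⟦ x ≟ a ⟧ ≡ 1
∑⟦≟⟧ {suc n} zero    =
  cong suc (∑-zero {n} (λ x → ⟦ suc x ≟ zero ⟧) λ x → ⟦⟧-no (suc x ≟ zero) λ ())
∑⟦≟⟧ {suc n} (suc a) =
  trans (sum-cong-≗ λ x → ⟦⟧-cong (mk⇔ (cong suc) suc-injective) (x ≟ a) (suc x ≟ suc a)) (∑⟦≟⟧ a)

∑-↑ : ∀ m n (f : Fin (m + n) → ℕ) → sum f ≡ ∑[ a < m ] f (a ↑ˡ n) + ∑[ b < n ] f (m ↑ʳ b)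
∑-↑ zero    n f = refl
∑-↑ (suc m) n f = trans (cong (f zero +_) (∑-↑ m n (f ∘ suc))) (sym (+-assoc (f zero) _ _))

∑-combine : ∀ k r (f : Fin (k * r) → ℕ) → sum f ≡ ∑[ a < k ] ∑[ b < r ] f (combine a b)
∑-combine zero    r f = refl
∑-combine (suc k) r f =
  trans (∑-↑ r (k * r) f) (cong (∑[ b < r ] f (b ↑ˡ k * r) +_) (∑-combine k r (f ∘ (r ↑ʳ_))))

sum-tabulate : ∀ {n} (f : Fin n → ℕ) → List.sum (tabulate f) ≡ sum f
sum-tabulate {zero}  f = refl
sum-tabulate {suc n} f = cong (f zero +_) (sum-tabulate (f ∘ suc))

sum-map-tabulate : ∀ {A : Set} {n} (f : A → ℕ) (g : Fin n → A) →
                   List.sum (map f (tabulate g)) ≡ ∑[ i < n ] f (g i)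
sum-map-tabulate f g = trans (cong List.sum (map-tabulate g f)) (sum-tabulate (f ∘ g))

module _ {A : Set} where

  sum-map-mono-≤ : ∀ (f g : A → ℕ) {xs} → All (λ x → f x ≤ g x) xs →
                   List.sum (map f xs) ≤ List.sum (map g xs)
  sum-map-mono-≤ f g []           = z≤n
  sum-map-mono-≤ f g (fx≤gx ∷ ps) = +-mono-≤ fx≤gx (sum-map-mono-≤ f g ps)

  sum-map-+ : ∀ (f g : A → ℕ) xs →
              List.sum (map (λ x → f x + g x) xs) ≡ List.sum (map f xs) + List.sum (map g xs)
  sum-map-+ f g []       = refl
  sum-map-+ f g (x ∷ xs) = trans (cong (f x + g x +_) (sum-map-+ f g xs)) (interchange (f x) (g x) _ _)

  sum-map-*ˡ : ∀ a (f : A → ℕ) xs → List.sum (map (λ x → a * f x) xs) ≡ a * List.sum (map f xs)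
  sum-map-*ˡ a f []       = sym (*-zeroʳ a)
  sum-map-*ˡ a f (x ∷ xs) = trans (cong (a * f x +_) (sum-map-*ˡ a f xs)) (sym (*-distribˡ-+ a (f x) _))

  ∑-sum-map-comm : ∀ {n} (F : Fin n → A → ℕ) xs →
                   ∑[ i < n ] List.sum (map (F i) xs) ≡ List.sum (map (λ x → ∑[ i < n ] F i x) xs)
  ∑-sum-map-comm {n} F []       = ∑-zero {n} (λ _ → 0) λ _ → refl
  ∑-sum-map-comm     F (x ∷ xs) =
    trans (∑-distrib-+ (λ i → F i x) _) (cong (∑[ i < _ ] F i x +_) (∑-sum-map-comm F xs))

  length-filter≡sum : ∀ {P : A → Set} (P? : ∀ x → Dec (P x)) xs →
                      length (filter P? xs) ≡ List.sum (map (λ x → ⟦ P? x ⟧) xs)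
  length-filter≡sum P? []       = refl
  length-filter≡sum P? (x ∷ xs) with does (P? x)
  ... | true  = cong suc (length-filter≡sum P? xs)
  ... | false = length-filter≡sum P? xs

∣∣≡∑⟦∈⟧ : ∀ {n} (p : Subset n) → ∣ p ∣ ≡ ∑[ x < n ] ⟦ x ∈? p ⟧
∣∣≡∑⟦∈⟧ []            = refl
∣∣≡∑⟦∈⟧ (inside  ∷ p) = cong suc (∣∣≡∑⟦∈⟧ p)
∣∣≡∑⟦∈⟧ (outside ∷ p) = ∣∣≡∑⟦∈⟧ p

∑⟦∈⟧*≡∣∣* : ∀ {n} (p : Subset n) a → ∑[ x < n ] (⟦ x ∈? p ⟧ * a) ≡ ∣ p ∣ * a
∑⟦∈⟧*≡∣∣* p a =
  trans (sym (*-distribʳ-sum a (λ x → ⟦ x ∈? p ⟧))) (cong (_* a) (sym (∣∣≡∑⟦∈⟧ p)))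

subsetOf : ∀ {n} {P : Fin n → Set} → (∀ x → Dec (P x)) → Subset n
subsetOf P? = Vec.tabulate (does ∘ P?)

∈-subsetOf : ∀ {n} {P : Fin n → Set} (P? : ∀ x → Dec (P x)) {x} → x ∈ subsetOf P? ⇔ P x
∈-subsetOf P? {x} = mk⇔
  (λ x∈ → does⇒ (P? x) (trans (sym (lookup∘tabulate _ x)) ([]=⇒lookup x∈)))
  (λ px → lookup⇒[]= x _ (trans (lookup∘tabulate _ x) (dec-true (P? x) px)))
  where
  does⇒ : ∀ {A : Set} (A? : Dec A) → does A? ≡ true → A
  does⇒ (yes a) _ = a

∣subsetOf∣ : ∀ {n} {P : Fin n → Set} (P? : ∀ x → Dec (P x)) →
             ∣ subsetOf P? ∣ ≡ ∑[ x < n ] ⟦ P? x ⟧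
∣subsetOf∣ P? = trans (∣∣≡∑⟦∈⟧ (subsetOf P?))
  (sum-cong-≗ λ x → ⟦⟧-cong (∈-subsetOf P?) (x ∈? subsetOf P?) (P? x))

∃-third : ∀ {n} (e : Subset n) → 2 < ∣ e ∣ → ∀ v w → ∃ λ x → x ∈ e × x ≢ v × x ≢ w
∃-third {n} e 2<∣e∣ v w = let x , P[x] = ∑>0⇒∃ _ ∑⟦P⟧>0 in x , ⟦⟧>0⇒ (P? x) P[x]
  where
  P? : ∀ x → Dec (x ∈ e × x ≢ v × x ≢ w)
  P? x = (x ∈? e) ×-dec (¬? (x ≟ v) ×-dec ¬? (x ≟ w))
  covered : ∀ x → ⟦ x ∈? e ⟧ ≤ ⟦ x ≟ v ⟧ + (⟦ x ≟ w ⟧ + ⟦ P? x ⟧)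
  covered x with x ∈? e | x ≟ v | x ≟ w
  ... | no  _ | _     | _     = z≤n
  ... | yes _ | yes _ | _     = s≤s z≤n
  ... | yes _ | no  _ | yes _ = s≤s z≤n
  ... | yes _ | no  _ | no  _ = s≤s z≤n
  ∑⟦P⟧>0 : 0 < ∑[ x < n ] ⟦ P? x ⟧
  ∑⟦P⟧>0 = +-cancelˡ-< 2 0 _ (begin-strict
    2
      <⟨ 2<∣e∣ ⟩
    ∣ e ∣
      ≡⟨ ∣∣≡∑⟦∈⟧ e ⟩
    ∑[ x < n ] ⟦ x ∈? e ⟧
      ≤⟨ ∑-mono-≤ covered ⟩
    ∑[ x < n ] (⟦ x ≟ v ⟧ + (⟦ x ≟ w ⟧ + ⟦ P? x ⟧))
      ≡⟨ ∑-distrib-+ (λ x → ⟦ x ≟ v ⟧) _ ⟩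
    ∑[ x < n ] ⟦ x ≟ v ⟧ + ∑[ x < n ] (⟦ x ≟ w ⟧ + ⟦ P? x ⟧)
      ≡⟨ cong₂ _+_ (∑⟦≟⟧ v) (∑-distrib-+ (λ x → ⟦ x ≟ w ⟧) _) ⟩
    1 + (∑[ x < n ] ⟦ x ≟ w ⟧ + ∑[ x < n ] ⟦ P? x ⟧)
      ≡⟨ cong (λ t → 1 + (t + ∑[ x < n ] ⟦ P? x ⟧)) (∑⟦≟⟧ w) ⟩
    2 + ∑[ x < n ] ⟦ P? x ⟧
      ∎)
    where open ≤-Reasoning

-- Monochromatic edges and recolouring

module _ {n k : ℕ} (c : Coloring n k) (e : Subset n) where

  ∈-colorsOf : ∀ {i} → i ∈ colorsOf c e ⇔ ∃ λ v → v ∈ e × c v ≡ i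
  ∈-colorsOf = ∈-subsetOf (λ i → any? λ v → (v ∈? e) ×-dec (c v ≟ i))

  NonMonochromatic : Set
  NonMonochromatic = 1 < ∣ colorsOf c e ∣

  nonMonochromatic? : Dec NonMonochromatic
  nonMonochromatic? = 1 <? ∣ colorsOf c e ∣

  Monochromatic : Set
  Monochromatic = ∀ {v w} → v ∈ e → w ∈ e → c v ≡ c w

  distinct⇒nonMonochromatic : ∀ {v w} → v ∈ e → w ∈ e → c v ≢ c w → NonMonochromatic
  distinct⇒nonMonochromatic v∈e w∈e cv≢cw =
    subst (1 <_) (sym (∣∣≡∑⟦∈⟧ (colorsOf c e))) (two⇒∑>1 _ cv≢cw (present v∈e) (present w∈e))
    where
    present : ∀ {v} → v ∈ e → 0 < ⟦ c v ∈? colorsOf c e ⟧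
    present {v} v∈e =
      ≤-reflexive (sym (⟦⟧-yes (c v ∈? colorsOf c e) (Equivalence.from ∈-colorsOf (v , v∈e , refl))))

  nonMonochromatic⇒¬monochromatic : NonMonochromatic → ¬ Monochromatic
  nonMonochromatic⇒¬monochromatic nm mono
    with i , j , i≢j , i∈ , j∈ ← ∑>1⇒two _ (λ i → ⟦⟧≤1 (i ∈? colorsOf c e))
                                           (subst (1 <_) (∣∣≡∑⟦∈⟧ (colorsOf c e)) nm)
    with v , v∈e , refl ← Equivalence.to (∈-colorsOf {i}) (⟦⟧>0⇒ (i ∈? colorsOf c e) i∈)
    with w , w∈e , refl ← Equivalence.to (∈-colorsOf {j}) (⟦⟧>0⇒ (j ∈? colorsOf c e) j∈)
    = i≢j (mono v∈e w∈e)

  ¬nonMonochromatic⇒monochromatic : ¬ NonMonochromatic → Monochromatic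
  ¬nonMonochromatic⇒monochromatic ¬nm {v} {w} v∈e w∈e =
    decidable-stable (c v ≟ c w) (¬nm ∘ distinct⇒nonMonochromatic v∈e w∈e)

nonMonochromatic-cong : ∀ {n k} {c c′ : Coloring n k} {e} → (∀ v → c v ≡ c′ v) →
                        NonMonochromatic c e → NonMonochromatic c′ e
nonMonochromatic-cong {c = c} {c′} {e} c≗c′ nm = decidable-stable (nonMonochromatic? c′ e) λ ¬nm′ →
  nonMonochromatic⇒¬monochromatic c e nm λ v∈e w∈e →
    trans (c≗c′ _) (trans (¬nonMonochromatic⇒monochromatic c′ e ¬nm′ v∈e w∈e) (sym (c≗c′ _)))

recolor-same : ∀ {n k} (c : Coloring n k) v i → recolor c v i v ≡ i
recolor-same c v i = cong (λ b → if b then i else c v) (dec-true (v ≟ v) refl)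

recolor-other : ∀ {n k} (c : Coloring n k) v i {w} → w ≢ v → recolor c v i w ≡ c w
recolor-other c v i {w} w≢v = cong (λ b → if b then i else c w) (dec-false (w ≟ v) w≢v)

recolor-cong : ∀ {n k} {c c′ : Coloring n k} → (∀ v → c v ≡ c′ v) →
               ∀ v i w → recolor c v i w ≡ recolor c′ v i w
recolor-cong c≗c′ v i w with does (w ≟ v)
... | true  = refl
... | false = c≗c′ w

Critical : ∀ {n k} → Coloring n k → Subset n → Fin n → Fin k → Set
Critical c e v i = NonMonochromatic c e × v ∈ e × ¬ NonMonochromatic (recolor c v i) e

critical? : ∀ {n k} (c : Coloring n k) e v i → Dec (Critical c e v i)
critical? c e v i = nonMonochromatic? c e ×-dec ((v ∈? e) ×-dec ¬? (nonMonochromatic? (recolor c v i) e))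

module _ {n k : ℕ} (c : Coloring n k) {e : Subset n} (2<∣e∣ : 2 < ∣ e ∣) where

  monochromatic⇒recolor-nonMonochromatic : Monochromatic c e → ∀ {v i} → v ∈ e → i ≢ c v →
                                          NonMonochromatic (recolor c v i) e
  monochromatic⇒recolor-nonMonochromatic mono {v} {i} v∈e i≢cv =
    let x , x∈e , x≢v , _ = ∃-third e 2<∣e∣ v v in
    distinct⇒nonMonochromatic (recolor c v i) e v∈e x∈e λ eq → i≢cv (begin
      i                ≡⟨ recolor-same c v i ⟨
      recolor c v i v  ≡⟨ eq ⟩
      recolor c v i x  ≡⟨ recolor-other c v i x≢v ⟩
      c x              ≡⟨ mono x∈e v∈e ⟩
      c v              ∎)
    where open ≡-Reasoning

  recolor-monochromatic⇒critical : ∀ {v i} → i ≢ c v → v ∈ e → ¬ NonMonochromatic (recolor c v i) e →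
                                   Critical c e v i
  recolor-monochromatic⇒critical i≢cv v∈e ¬nm′ = nm , v∈e , ¬nm′
    where
    nm : NonMonochromatic c e
    nm = decidable-stable (nonMonochromatic? c e) λ ¬nm → ¬nm′
           (monochromatic⇒recolor-nonMonochromatic (¬nonMonochromatic⇒monochromatic c e ¬nm) v∈e i≢cv)

  recolor-monochromatic-unique : NonMonochromatic c e → ∀ {v w i j} →
    v ∈ e → Monochromatic (recolor c v i) e → w ∈ e → Monochromatic (recolor c w j) e → v ≡ w × i ≡ j
  recolor-monochromatic-unique nm {v} {w} {i} {j} v∈e monoᵛ w∈e monoʷ with v ≟ w
  ... | yes refl with x , x∈e , x≢v , _ ← ∃-third e 2<∣e∣ v v = refl , (begin
      i                ≡⟨ recolor-same c v i ⟨
      recolor c v i v  ≡⟨ monoᵛ v∈e x∈e ⟩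
      recolor c v i x  ≡⟨ recolor-other c v i x≢v ⟩
      c x              ≡⟨ recolor-other c v j x≢v ⟨
      recolor c v j x  ≡⟨ monoʷ x∈e v∈e ⟩
      recolor c v j v  ≡⟨ recolor-same c v j ⟩
      j                ∎)
    where open ≡-Reasoning
  ... | no v≢w with x , x∈e , x≢v , x≢w ← ∃-third e 2<∣e∣ v w =
    ⊥-elim (nonMonochromatic⇒¬monochromatic c e nm λ y∈e z∈e → trans (≡cx y∈e) (sym (≡cx z∈e)))
    where
    ≡cx : ∀ {y} → y ∈ e → c y ≡ c x
    ≡cx {y} y∈e with y ≟ v
    ... | yes refl = trans (sym (recolor-other c w j v≢w)) (trans (monoʷ y∈e x∈e) (recolor-other c w j x≢w))
    ... | no y≢v   = trans (sym (recolor-other c v i y≢v)) (trans (monoᵛ y∈e x∈e) (recolor-other c v i x≢v))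

  ∑∑⟦critical⟧≤⟦nonMonochromatic⟧ :
    ∑[ v < n ] ∑[ i < k ] ⟦ critical? c e v i ⟧ ≤ ⟦ nonMonochromatic? c e ⟧
  ∑∑⟦critical⟧≤⟦nonMonochromatic⟧ = bound (nonMonochromatic? c e)
    where
    bound : (nm? : Dec (NonMonochromatic c e)) → ∑[ v < n ] ∑[ i < k ] ⟦ critical? c e v i ⟧ ≤ ⟦ nm? ⟧
    bound (no ¬nm) =
      ≤-reflexive (∑-zero _ λ v → ∑-zero _ λ i → ⟦⟧-no (critical? c e v i) (¬nm ∘ proj₁))
    bound (yes nm) = ∑∑-≤1 _ (λ v i → ⟦⟧≤1 (critical? c e v i)) λ {v} {i} {w} {j} crit crit′ →
      let _ , v∈e , ¬nmᵛ = ⟦⟧>0⇒ (critical? c e v i) crit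
          _ , w∈e , ¬nmʷ = ⟦⟧>0⇒ (critical? c e w j) crit′
      in recolor-monochromatic-unique nm v∈e (¬nonMonochromatic⇒monochromatic _ e ¬nmᵛ)
                                         w∈e (¬nonMonochromatic⇒monochromatic _ e ¬nmʷ)

-- Welfare at an equilibrium

utility≡ : ∀ {n k} (H : Hypergraph n) (c : Coloring n k) v →
           utility H c v ≡ List.sum (map (λ e → ⟦ v ∈? e ⟧ * ⟦ nonMonochromatic? c e ⟧) H)
utility≡ H c v = trans (length-filter≡sum _ H)
  (cong List.sum (map-cong (λ e → ⟦×-dec⟧ (v ∈? e) (nonMonochromatic? c e)) H))

SW≡ : ∀ {n k} (H : Hypergraph n) (c : Coloring n k) →
      SW H c ≡ List.sum (map (λ e → ∣ e ∣ * ⟦ nonMonochromatic? c e ⟧) H)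
SW≡ {n} H c = begin
  List.sum (map (utility H c) (allFin n))
    ≡⟨ sum-map-tabulate (utility H c) id ⟩
  ∑[ v < n ] utility H c v
    ≡⟨ sum-cong-≗ (utility≡ H c) ⟩
  ∑[ v < n ] List.sum (map (λ e → ⟦ v ∈? e ⟧ * ν e) H)
    ≡⟨ ∑-sum-map-comm (λ v e → ⟦ v ∈? e ⟧ * ν e) H ⟩
  List.sum (map (λ e → ∑[ v < n ] (⟦ v ∈? e ⟧ * ν e)) H)
    ≡⟨ cong List.sum (map-cong (λ e → ∑⟦∈⟧*≡∣∣* e (ν e)) H) ⟩
  List.sum (map (λ e → ∣ e ∣ * ν e) H)
    ∎
  where
  open ≡-Reasoning
  ν : Subset n → ℕ
  ν e = ⟦ nonMonochromatic? c e ⟧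

SW≡r*#nonMonochromatic : ∀ {n k r} (H : Hypergraph n) (c : Coloring n k) → All (λ e → ∣ e ∣ ≡ r) H →
                         SW H c ≡ r * List.sum (map (λ e → ⟦ nonMonochromatic? c e ⟧) H)
SW≡r*#nonMonochromatic {r = r} H c ∣e∣≡r = trans (SW≡ H c) (trans
  (cong List.sum (map-cong-local {f = λ e → ∣ e ∣ * ν e} {g = λ e → r * ν e}
    (All.map (λ {e} ∣e∣≡r → cong (_* ν e) ∣e∣≡r) ∣e∣≡r)))
  (sum-map-*ˡ r ν H))
  where
  ν : Subset _ → ℕ
  ν e = ⟦ nonMonochromatic? c e ⟧

module _ {n k : ℕ} (H : Hypergraph n) {c c′ : Coloring n k} (c≗c′ : ∀ v → c v ≡ c′ v) where

  ⟦nonMonochromatic⟧-cong : ∀ e → ⟦ nonMonochromatic? c e ⟧ ≡ ⟦ nonMonochromatic? c′ e ⟧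
  ⟦nonMonochromatic⟧-cong e =
    ⟦⟧-cong (mk⇔ (nonMonochromatic-cong c≗c′) (nonMonochromatic-cong (sym ∘ c≗c′)))
            (nonMonochromatic? c e) (nonMonochromatic? c′ e)

  utility-cong : ∀ v → utility H c v ≡ utility H c′ v
  utility-cong v = trans (utility≡ H c v) (trans
    (cong List.sum (map-cong (λ e → cong (⟦ v ∈? e ⟧ *_) (⟦nonMonochromatic⟧-cong e)) H))
    (sym (utility≡ H c′ v)))

  SW-cong : SW H c ≡ SW H c′
  SW-cong = trans (SW≡ H c) (trans
    (cong List.sum (map-cong (λ e → cong (∣ e ∣ *_) (⟦nonMonochromatic⟧-cong e)) H))
    (sym (SW≡ H c′)))

isNash-cong : ∀ {n k} (H : Hypergraph n) {c c′ : Coloring n k} → (∀ v → c v ≡ c′ v) →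
              IsNash H c → IsNash H c′
isNash-cong H c≗c′ nash v i =
  subst₂ _≤_ (utility-cong H (recolor-cong c≗c′ v i) v) (utility-cong H c≗c′ v) (nash v i)

module WelfareBound {n k r : ℕ} (H : Hypergraph n) (2<r : 2 < r) (r-minimal : RMinimal r H)
                    (c : Coloring n k) (nash : IsNash H c) where

  ν μ : Subset n → ℕ
  ν e = ⟦ nonMonochromatic? c e ⟧
  μ e = ⟦ ¬? (nonMonochromatic? c e) ⟧

  monoWeight nonMonoCount : ℕ
  monoWeight   = List.sum (map (λ e → ∣ e ∣ * μ e) H)
  nonMonoCount = List.sum (map ν H)

  2<∣e∣ : All (λ e → 2 < ∣ e ∣) H
  2<∣e∣ = All.map (≤-trans 2<r) r-minimal

  monoAt : Fin n → ℕ
  monoAt v = List.sum (map (λ e → ⟦ v ∈? e ⟧ * μ e) H)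

  criticalAt : Fin n → Fin k → ℕ
  criticalAt v i = List.sum (map (λ e → ⟦ critical? c e v i ⟧) H)

  monoAt≤criticalAt : ∀ v {i} → i ≢ c v → monoAt v ≤ criticalAt v i
  monoAt≤criticalAt v {i} i≢cv = +-cancelˡ-≤ (utility H c v) _ _ (begin
    utility H c v + monoAt v
      ≡⟨ cong (_+ monoAt v) (utility≡ H c v) ⟩
    List.sum (map (λ e → ⟦ v ∈? e ⟧ * ν e) H) + monoAt v
      ≡⟨ sum-map-+ (λ e → ⟦ v ∈? e ⟧ * ν e) (λ e → ⟦ v ∈? e ⟧ * μ e) H ⟨
    List.sum (map (λ e → ⟦ v ∈? e ⟧ * ν e + ⟦ v ∈? e ⟧ * μ e) H)
      ≡⟨ cong List.sum (map-cong split H) ⟩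
    List.sum (map (λ e → ⟦ v ∈? e ⟧) H)
      ≤⟨ sum-map-mono-≤ _ _ (All.map edge-bound 2<∣e∣) ⟩
    List.sum (map (λ e → ⟦ v ∈? e ⟧ * ν′ e + ⟦ critical? c e v i ⟧) H)
      ≡⟨ sum-map-+ (λ e → ⟦ v ∈? e ⟧ * ν′ e) (λ e → ⟦ critical? c e v i ⟧) H ⟩
    List.sum (map (λ e → ⟦ v ∈? e ⟧ * ν′ e) H) + criticalAt v i
      ≡⟨ cong (_+ criticalAt v i) (utility≡ H (recolor c v i) v) ⟨
    utility H (recolor c v i) v + criticalAt v i
      ≤⟨ +-monoˡ-≤ (criticalAt v i) (nash v i) ⟩
    utility H c v + criticalAt v i ∎)
    where
    open ≤-Reasoning
    ν′ : Subset n → ℕ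
    ν′ e = ⟦ nonMonochromatic? (recolor c v i) e ⟧
    split : ∀ e → ⟦ v ∈? e ⟧ * ν e + ⟦ v ∈? e ⟧ * μ e ≡ ⟦ v ∈? e ⟧
    split e = trans (sym (*-distribˡ-+ ⟦ v ∈? e ⟧ (ν e) (μ e)))
                    (trans (cong (⟦ v ∈? e ⟧ *_) (⟦⟧+⟦¬?⟧ (nonMonochromatic? c e))) (*-identityʳ _))
    edge-bound : ∀ {e} → 2 < ∣ e ∣ → ⟦ v ∈? e ⟧ ≤ ⟦ v ∈? e ⟧ * ν′ e + ⟦ critical? c e v i ⟧
    edge-bound {e} 2<∣e∣ =
      ⟦⟧≤⟦⟧*⟦⟧+⟦⟧ (v ∈? e) (nonMonochromatic? (recolor c v i) e) (critical? c e v i)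
                  (recolor-monochromatic⇒critical c 2<∣e∣ i≢cv)

  [k-1]*monoWeight≤nonMonoCount : (k ∸ 1) * monoWeight ≤ nonMonoCount
  [k-1]*monoWeight≤nonMonoCount = begin
    (k ∸ 1) * monoWeight
      ≡⟨ cong ((k ∸ 1) *_) ∑monoAt ⟨
    (k ∸ 1) * ∑[ v < n ] monoAt v
      ≡⟨ *-distribˡ-sum (k ∸ 1) monoAt ⟩
    ∑[ v < n ] ((k ∸ 1) * monoAt v)
      ≤⟨ ∑-mono-≤ (λ v → ∑-except (criticalAt v) (c v) (monoAt v) λ i → monoAt≤criticalAt v) ⟩
    ∑[ v < n ] ∑[ i < k ] criticalAt v i
      ≡⟨ sum-cong-≗ (λ v → ∑-sum-map-comm (λ i e → ⟦ critical? c e v i ⟧) H) ⟩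
    ∑[ v < n ] List.sum (map (λ e → ∑[ i < k ] ⟦ critical? c e v i ⟧) H)
      ≡⟨ ∑-sum-map-comm (λ v e → ∑[ i < k ] ⟦ critical? c e v i ⟧) H ⟩
    List.sum (map (λ e → ∑[ v < n ] ∑[ i < k ] ⟦ critical? c e v i ⟧) H)
      ≤⟨ sum-map-mono-≤ _ ν (All.map (∑∑⟦critical⟧≤⟦nonMonochromatic⟧ c) 2<∣e∣) ⟩
    nonMonoCount
      ∎
    where
    open ≤-Reasoning
    ∑monoAt : ∑[ v < n ] monoAt v ≡ monoWeight
    ∑monoAt = trans (∑-sum-map-comm (λ v e → ⟦ v ∈? e ⟧ * μ e) H)
                    (cong List.sum (map-cong (λ e → ∑⟦∈⟧*≡∣∣* e (μ e)) H))

  r*nonMonoCount≤SW : r * nonMonoCount ≤ SW H c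
  r*nonMonoCount≤SW = begin
    r * nonMonoCount                      ≡⟨ sum-map-*ˡ r ν H ⟨
    List.sum (map (λ e → r * ν e) H)      ≤⟨ sum-map-mono-≤ _ _ (All.map (*-monoˡ-≤ _) r-minimal) ⟩
    List.sum (map (λ e → ∣ e ∣ * ν e) H)  ≡⟨ SW≡ H c ⟨
    SW H c                                ∎
    where open ≤-Reasoning

  SW≤SW+monoWeight : ∀ (c′ : Coloring n k) → SW H c′ ≤ SW H c + monoWeight
  SW≤SW+monoWeight c′ = begin
    SW H c′
      ≡⟨ SW≡ H c′ ⟩
    List.sum (map (λ e → ∣ e ∣ * ⟦ nonMonochromatic? c′ e ⟧) H)
      ≤⟨ sum-map-mono-≤ _ _ (All.universal ≤∣e∣ H) ⟩
    List.sum (map (λ e → ∣ e ∣ * 1) H)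
      ≡⟨ cong List.sum (map-cong split H) ⟩
    List.sum (map (λ e → ∣ e ∣ * ν e + ∣ e ∣ * μ e) H)
      ≡⟨ sum-map-+ (λ e → ∣ e ∣ * ν e) _ H ⟩
    List.sum (map (λ e → ∣ e ∣ * ν e) H) + monoWeight
      ≡⟨ cong (_+ monoWeight) (SW≡ H c) ⟨
    SW H c + monoWeight
      ∎
    where
    open ≤-Reasoning
    ≤∣e∣ : ∀ e → ∣ e ∣ * ⟦ nonMonochromatic? c′ e ⟧ ≤ ∣ e ∣ * 1
    ≤∣e∣ e = *-monoʳ-≤ ∣ e ∣ (⟦⟧≤1 (nonMonochromatic? c′ e))
    split : ∀ e → ∣ e ∣ * 1 ≡ ∣ e ∣ * ν e + ∣ e ∣ * μ e
    split e = trans (cong (∣ e ∣ *_) (sym (⟦⟧+⟦¬?⟧ (nonMonochromatic? c e))))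
                    (*-distribˡ-+ ∣ e ∣ (ν e) (μ e))

  SW*d≤SW*[d+1] : ∀ (c′ : Coloring n k) → SW H c′ * ((k ∸ 1) * r) ≤ SW H c * ((k ∸ 1) * r + 1)
  SW*d≤SW*[d+1] c′ = begin
    SW H c′ * d                  ≤⟨ *-monoˡ-≤ d (SW≤SW+monoWeight c′) ⟩
    (SW H c + monoWeight) * d    ≡⟨ *-distribʳ-+ d (SW H c) monoWeight ⟩
    SW H c * d + monoWeight * d  ≤⟨ +-monoʳ-≤ (SW H c * d) monoWeight*d≤SW ⟩
    SW H c * d + SW H c          ≡⟨ cong (SW H c * d +_) (*-identityʳ (SW H c)) ⟨
    SW H c * d + SW H c * 1      ≡⟨ *-distribˡ-+ (SW H c) d 1 ⟨
    SW H c * (d + 1)             ∎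
    where
    open ≤-Reasoning
    d : ℕ
    d = (k ∸ 1) * r
    monoWeight*d≤SW : monoWeight * d ≤ SW H c
    monoWeight*d≤SW = begin
      monoWeight * ((k ∸ 1) * r)  ≡⟨ *-assoc monoWeight (k ∸ 1) r ⟨
      monoWeight * (k ∸ 1) * r    ≡⟨ cong (_* r) (*-comm monoWeight (k ∸ 1)) ⟩
      (k ∸ 1) * monoWeight * r    ≤⟨ *-monoˡ-≤ r [k-1]*monoWeight≤nonMonoCount ⟩
      nonMonoCount * r            ≡⟨ *-comm nonMonoCount r ⟩
      r * nonMonoCount            ≤⟨ r*nonMonoCount≤SW ⟩
      SW H c                      ∎

-- The optimum and the worst equilibrium

∈⇒≤maxL : ∀ {x xs} → x ∈ₗ xs → x ≤ maxL xs
∈⇒≤maxL {xs = y ∷ xs} (here refl) = m≤m⊔n y (maxL xs)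
∈⇒≤maxL {xs = y ∷ xs} (there x∈)  = ≤-trans (∈⇒≤maxL x∈) (m≤n⊔m y (maxL xs))

maxL≡0⊎∈ : ∀ xs → maxL xs ≡ 0 ⊎ maxL xs ∈ₗ xs
maxL≡0⊎∈ []       = inj₁ refl
maxL≡0⊎∈ (x ∷ xs) with ⊔-sel x (maxL xs) | maxL≡0⊎∈ xs
... | inj₁ ≡x | _         = inj₂ (here ≡x)
... | inj₂ ≡m | inj₁ m≡0  = inj₁ (trans ≡m m≡0)
... | inj₂ ≡m | inj₂ m∈xs = inj₂ (subst (_∈ₗ x ∷ xs) (sym ≡m) (there m∈xs))

minL≤∈ : ∀ {x xs} → x ∈ₗ xs → minL xs ≤ x
minL≤∈ {xs = y ∷ []}     (here refl) = ≤-refl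
minL≤∈ {xs = y ∷ z ∷ xs} (here refl) = m⊓n≤m y (minL (z ∷ xs))
minL≤∈ {xs = y ∷ z ∷ xs} (there x∈)  = ≤-trans (m⊓n≤n y (minL (z ∷ xs))) (minL≤∈ x∈)

minL-∷∈ : ∀ x xs → minL (x ∷ xs) ∈ₗ x ∷ xs
minL-∷∈ x []       = here refl
minL-∷∈ x (y ∷ xs) with ⊓-sel x (minL (y ∷ xs))
... | inj₁ ≡x = here ≡x
... | inj₂ ≡m = subst (_∈ₗ x ∷ y ∷ xs) (sym ≡m) (there (minL-∷∈ y xs))

minL∈ : ∀ {x xs} → x ∈ₗ xs → minL xs ∈ₗ xs
minL∈ {xs = y ∷ xs} _ = minL-∷∈ y xs

minL≢0⇒∃∈ : ∀ {xs} → minL xs ≢ 0 → ∃ λ x → x ∈ₗ xs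
minL≢0⇒∃∈ {[]}     minL≢0 = ⊥-elim (minL≢0 refl)
minL≢0⇒∃∈ {x ∷ xs} _      = x , here refl

allColorings-complete : ∀ n k (c : Coloring n k) →
                        ∃ λ c₀ → c₀ ∈ₗ allColorings n k × (∀ v → c₀ v ≡ c v)
allColorings-complete zero    k c = (λ ()) , here refl , λ ()
allColorings-complete (suc n) k c with c₁ , c₁∈ , c₁≗ ← allColorings-complete n k (c ∘ suc) =
  _ , ∈-concatMap⁺ _ (lose c₁∈ (∈-map⁺ _ (∈-allFin (c zero)))) , λ { zero → refl ; (suc v) → c₁≗ v }

module _ {n : ℕ} (H : Hypergraph n) (k : ℕ) where

  SW≤Opt : ∀ c → SW H c ≤ Opt H k
  SW≤Opt c with c₀ , c₀∈ , c₀≗c ← allColorings-complete n k c =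
    subst (_≤ Opt H k) (SW-cong H c₀≗c) (∈⇒≤maxL (∈-map⁺ (SW H) c₀∈))

  Opt*-lub : ∀ {d B} → (∀ c → SW H c * d ≤ B) → Opt H k * d ≤ B
  Opt*-lub {d} {B} SW*d≤B with maxL≡0⊎∈ (map (SW H) (allColorings n k))
  ... | inj₁ Opt≡0 = subst (λ o → o * d ≤ B) (sym Opt≡0) z≤n
  ... | inj₂ Opt∈  =
    let c , _ , Opt≡ = ∈-map⁻ (SW H) Opt∈ in subst (λ o → o * d ≤ B) (sym Opt≡) (SW*d≤B c)

  NE≤SW : ∀ c → IsNash H c → NE H k ≤ SW H c
  NE≤SW c nash with c₀ , c₀∈ , c₀≗c ← allColorings-complete n k c =
    subst (NE H k ≤_) (SW-cong H c₀≗c)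
      (minL≤∈ (∈-map⁺ (SW H) (∈-filter⁺ (isNash? H) c₀∈ (isNash-cong H (sym ∘ c₀≗c) nash))))

  NE-attained : ∀ c₀ → IsNash H c₀ → ∃ λ c → IsNash H c × NE H k ≡ SW H c
  NE-attained c₀ nash₀ with c₁ , c₁∈ , c₁≗c₀ ← allColorings-complete n k c₀ =
    let nash₁ = isNash-cong H (sym ∘ c₁≗c₀) nash₀
        c , c∈ , NE≡ = ∈-map⁻ (SW H) (minL∈ (∈-map⁺ (SW H) (∈-filter⁺ (isNash? H) c₁∈ nash₁)))
    in c , proj₂ (∈-filter⁻ (isNash? H) {xs = allColorings n k} c∈) , NE≡

  NE≢0⇒∃nash : NE H k ≢ 0 → ∃ (IsNash H)
  NE≢0⇒∃nash NE≢0 = nash-of (minL≢0⇒∃∈ NE≢0)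
    where
    nash-of : ∃ (_∈ₗ map (SW H) (filter (isNash? H) (allColorings n k))) → ∃ (IsNash H)
    nash-of (_ , w∈) with c , c∈ , _ ← ∈-map⁻ (SW H) w∈ =
      c , proj₂ (∈-filter⁻ (isNash? H) {xs = allColorings n k} c∈)

Opt*d≤NE*[d+1] : ∀ {n r} k (H : Hypergraph n) → 2 < r → RMinimal r H → NE H k ≢ 0 →
                 Opt H k * ((k ∸ 1) * r) ≤ NE H k * ((k ∸ 1) * r + 1)
Opt*d≤NE*[d+1] {r = r} k H 2<r r-minimal NE≢0 =
  let c₀ , nash₀ = NE≢0⇒∃nash H k NE≢0
      c , nash , NE≡ = NE-attained H k c₀ nash₀
  in subst (λ m → Opt H k * ((k ∸ 1) * r) ≤ m * ((k ∸ 1) * r + 1)) (sym NE≡)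
       (Opt*-lub H k (WelfareBound.SW*d≤SW*[d+1] H 2<r r-minimal c nash))

-- A tight instance

-- The vertices of Fin (k * r) are the cells (row v, col v) of a k × r grid. An edge is the
-- graph { (σ b , b) } of a map σ : Fin r → Fin k, so it has exactly r vertices.
module Construction (k₀ r₀ : ℕ) where

  k r L : ℕ
  k = suc (suc k₀)
  r = suc (suc r₀)
  L = (k ∸ 1) * r

  row : Fin (k * r) → Fin k
  row v = proj₁ (remQuot {k} r v)

  col : Fin (k * r) → Fin r
  col v = proj₂ (remQuot {k} r v)

  row-combine : ∀ (a : Fin k) (b : Fin r) → row (combine a b) ≡ a
  row-combine a b = cong proj₁ (remQuot-combine a b)

  col-combine : ∀ (a : Fin k) (b : Fin r) → col (combine a b) ≡ b
  col-combine a b = cong proj₂ (remQuot-combine a b)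

  row-col-injective : ∀ {v w} → row v ≡ row w → col v ≡ col w → v ≡ w
  row-col-injective {v} {w} rv≡rw cv≡cw =
    trans (sym (combine-remQuot {k} r v)) (trans (cong₂ combine rv≡rw cv≡cw) (combine-remQuot {k} r w))

  graph : (Fin r → Fin k) → Subset (k * r)
  graph σ = subsetOf (λ v → row v ≟ σ (col v))

  ∈-graph : ∀ σ {v} → v ∈ graph σ ⇔ row v ≡ σ (col v)
  ∈-graph σ = ∈-subsetOf (λ v → row v ≟ σ (col v))

  combine∈graph : ∀ σ {a : Fin k} {b : Fin r} → a ≡ σ b → combine a b ∈ graph σ
  combine∈graph σ {a} {b} a≡σb =
    Equivalence.from (∈-graph σ) (trans (row-combine a b) (trans a≡σb (cong σ (sym (col-combine a b)))))

  ∣graph∣ : ∀ σ → ∣ graph σ ∣ ≡ r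
  ∣graph∣ σ = begin
    ∣ graph σ ∣                                ≡⟨ ∣subsetOf∣ (λ v → row v ≟ σ (col v)) ⟩
    ∑[ v < k * r ] ⟦ row v ≟ σ (col v) ⟧       ≡⟨ ∑-combine k r (λ v → ⟦ row v ≟ σ (col v) ⟧) ⟩
    ∑[ a < k ] ∑[ b < r ] ⟦ row (combine a b) ≟ σ (col (combine a b)) ⟧
      ≡⟨ sum-cong-≗ (λ a → sum-cong-≗ λ b →
           cong (λ p → ⟦ proj₁ p ≟ σ (proj₂ p) ⟧) (remQuot-combine a b)) ⟩
    ∑[ a < k ] ∑[ b < r ] ⟦ a ≟ σ b ⟧          ≡⟨ ∑-comm (λ a b → ⟦ a ≟ σ b ⟧) ⟩
    ∑[ b < r ] ∑[ a < k ] ⟦ a ≟ σ b ⟧          ≡⟨ sum-cong-≗ (λ b → ∑⟦≟⟧ (σ b)) ⟩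
    ∑[ b < r ] 1                               ≡⟨ ∑-const r 1 ⟩
    r * 1                                      ≡⟨ *-identityʳ r ⟩
    r                                          ∎
    where open ≡-Reasoning

  base : Subset (k * r)
  base = graph (λ _ → zero)

  -- cell (0, j) together with row 1 + i minus its cell in column j
  cross : Fin (suc k₀) → Fin r → Subset (k * r)
  cross i j = graph (recolor (λ _ → suc i) j zero)

  crossAt : Fin L → Subset (k * r)
  crossAt t = cross (proj₁ (remQuot {suc k₀} r t)) (proj₂ (remQuot {suc k₀} r t))

  ∀crossAt : ∀ (P : Subset (k * r) → Set) → (∀ i j → P (cross i j)) → ∀ t → P (crossAt t)
  ∀crossAt P P[cross] t = P[cross] (proj₁ (remQuot {suc k₀} r t)) (proj₂ (remQuot {suc k₀} r t))

  crossAt-combine : ∀ i j → crossAt (combine i j) ≡ cross i j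
  crossAt-combine i j = cong (λ p → cross (proj₁ p) (proj₂ p)) (remQuot-combine i j)

  H : Hypergraph (k * r)
  H = base ∷ tabulate crossAt

  ∣H∣≡r : All (λ e → ∣ e ∣ ≡ r) H
  ∣H∣≡r = ∣graph∣ (λ _ → zero) ∷
    tabulate⁺ {f = crossAt} (∀crossAt (λ e → ∣ e ∣ ≡ r) λ i j → ∣graph∣ (recolor (λ _ → suc i) j zero))

  #nonMonochromatic-split : ∀ (c : Coloring (k * r) k) → List.sum (map (λ e → ⟦ nonMonochromatic? c e ⟧) H) ≡
    ⟦ nonMonochromatic? c base ⟧ + ∑[ t < L ] ⟦ nonMonochromatic? c (crossAt t) ⟧
  #nonMonochromatic-split c =
    cong (⟦ nonMonochromatic? c base ⟧ +_) (sum-map-tabulate (λ e → ⟦ nonMonochromatic? c e ⟧) crossAt)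

  utility-split : ∀ (c : Coloring (k * r) k) v → utility H c v ≡
    ⟦ v ∈? base ⟧ * ⟦ nonMonochromatic? c base ⟧ +
    ∑[ t < L ] (⟦ v ∈? crossAt t ⟧ * ⟦ nonMonochromatic? c (crossAt t) ⟧)
  utility-split c v = trans (utility≡ H c v) (cong (⟦ v ∈? base ⟧ * ⟦ nonMonochromatic? c base ⟧ +_)
    (sum-map-tabulate (λ e → ⟦ v ∈? e ⟧ * ⟦ nonMonochromatic? c e ⟧) crossAt))

  other : Fin r → Fin r
  other zero    = suc zero
  other (suc _) = zero

  other≢ : ∀ j → other j ≢ j
  other≢ zero    ()
  other≢ (suc _) ()

  cross-nonMonochromatic : ∀ (c : Coloring (k * r) k) i j →
    c (combine {k} zero j) ≢ c (combine (suc i) (other j)) → NonMonochromatic c (cross i j)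
  cross-nonMonochromatic c i j = distinct⇒nonMonochromatic c (cross i j)
    (combine∈graph (recolor (λ _ → suc i) j zero) (sym (recolor-same (λ _ → suc i) j zero)))
    (combine∈graph (recolor (λ _ → suc i) j zero) (sym (recolor-other (λ _ → suc i) j zero (other≢ j))))

  row-base-monochromatic : Monochromatic row base
  row-base-monochromatic v∈ w∈ = trans (Equivalence.to (∈-graph _) v∈) (sym (Equivalence.to (∈-graph _) w∈))

  row-cross-nonMonochromatic : ∀ i j → NonMonochromatic row (cross i j)
  row-cross-nonMonochromatic i j = cross-nonMonochromatic row i j λ eq →
    Finₚ.0≢1+n (trans (sym (row-combine zero j)) (trans eq (row-combine (suc i) (other j))))

  ⟦row-base⟧≡0 : ⟦ nonMonochromatic? row base ⟧ ≡ 0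
  ⟦row-base⟧≡0 = ⟦⟧-no (nonMonochromatic? row base) λ nm →
    nonMonochromatic⇒¬monochromatic row base nm row-base-monochromatic

  ⟦row-cross⟧≡1 : ∀ t → ⟦ nonMonochromatic? row (crossAt t) ⟧ ≡ 1
  ⟦row-cross⟧≡1 t = ⟦⟧-yes (nonMonochromatic? row (crossAt t))
    (∀crossAt (NonMonochromatic row) row-cross-nonMonochromatic t)

  SW-row : SW H row ≡ r * L
  SW-row = begin
    SW H row
      ≡⟨ SW≡r*#nonMonochromatic H row ∣H∣≡r ⟩
    r * List.sum (map (λ e → ⟦ nonMonochromatic? row e ⟧) H)
      ≡⟨ cong (r *_) (#nonMonochromatic-split row) ⟩
    r * (⟦ nonMonochromatic? row base ⟧ + ∑[ t < L ] ⟦ nonMonochromatic? row (crossAt t) ⟧)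
      ≡⟨ cong (r *_) (cong₂ _+_ ⟦row-base⟧≡0 (sum-cong-≗ ⟦row-cross⟧≡1)) ⟩
    r * ∑[ t < L ] 1
      ≡⟨ cong (r *_) (trans (∑-const L 1) (*-identityʳ L)) ⟩
    r * L
      ∎
    where open ≡-Reasoning

  -- colouring by rows, except that the cells (0, 0) and (1, 1) exchange their colours 0 and 1
  twisted : Fin k → Fin r → Fin k
  twisted zero          zero       = suc zero
  twisted zero          (suc _)    = zero
  twisted (suc zero)    (suc zero) = zero
  twisted (suc zero)    _          = suc zero
  twisted (suc (suc a)) _          = suc (suc a)

  twisted-other : ∀ i j → twisted zero j ≢ twisted (suc i) (other j)
  twisted-other zero    zero    ()
  twisted-other (suc _) zero    ()
  twisted-other zero    (suc _) ()
  twisted-other (suc _) (suc _) ()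

  twistedColoring : Coloring (k * r) k
  twistedColoring v = twisted (row v) (col v)

  twistedColoring-combine : ∀ (a : Fin k) (b : Fin r) → twistedColoring (combine a b) ≡ twisted a b
  twistedColoring-combine a b = cong (λ p → twisted (proj₁ p) (proj₂ p)) (remQuot-combine a b)

  twisted-base-nonMonochromatic : NonMonochromatic twistedColoring base
  twisted-base-nonMonochromatic = distinct⇒nonMonochromatic twistedColoring base
    (combine∈graph (λ _ → zero) {zero} {zero} refl) (combine∈graph (λ _ → zero) {zero} {suc zero} refl) λ eq →
      twisted-other zero zero
        (trans (sym (twistedColoring-combine zero zero)) (trans eq (twistedColoring-combine zero (suc zero))))

  twisted-cross-nonMonochromatic : ∀ i j → NonMonochromatic twistedColoring (cross i j)
  twisted-cross-nonMonochromatic i j = cross-nonMonochromatic twistedColoring i j λ eq →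
    twisted-other i j (trans (sym (twistedColoring-combine zero j)) (trans eq (twistedColoring-combine (suc i) (other j))))

  SW-twisted : SW H twistedColoring ≡ r * suc L
  SW-twisted = begin
    SW H twistedColoring
      ≡⟨ SW≡r*#nonMonochromatic H twistedColoring ∣H∣≡r ⟩
    r * List.sum (map (λ e → ⟦ nonMonochromatic? twistedColoring e ⟧) H)
      ≡⟨ cong (r *_) (#nonMonochromatic-split twistedColoring) ⟩
    r * (⟦ nonMonochromatic? twistedColoring base ⟧ + ∑[ t < L ] ⟦ nonMonochromatic? twistedColoring (crossAt t) ⟧)
      ≡⟨ cong (r *_) (cong₂ _+_ base≡1 (sum-cong-≗ cross≡1)) ⟩
    r * (1 + ∑[ t < L ] 1)
      ≡⟨ cong (λ m → r * suc m) (trans (∑-const L 1) (*-identityʳ L)) ⟩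
    r * suc L
      ∎
    where
    open ≡-Reasoning
    base≡1 : ⟦ nonMonochromatic? twistedColoring base ⟧ ≡ 1
    base≡1 = ⟦⟧-yes (nonMonochromatic? twistedColoring base) twisted-base-nonMonochromatic
    cross≡1 : ∀ t → ⟦ nonMonochromatic? twistedColoring (crossAt t) ⟧ ≡ 1
    cross≡1 t = ⟦⟧-yes (nonMonochromatic? twistedColoring (crossAt t))
      (∀crossAt (NonMonochromatic twistedColoring) twisted-cross-nonMonochromatic t)

  ∈base⇒∈cross : ∀ {v} i → v ∈ base → v ∈ cross i (col v)
  ∈base⇒∈cross {v} i v∈ = Equivalence.from (∈-graph (recolor (λ _ → suc i) (col v) zero))
    (trans (Equivalence.to (∈-graph (λ _ → zero)) v∈) (sym (recolor-same (λ _ → suc i) (col v) zero)))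

  recolor-base-monochromatic : ∀ {v} → v ∈ base → Monochromatic (recolor row v zero) base
  recolor-base-monochromatic {v} v∈ w∈ w′∈ = trans (≡zero w∈) (sym (≡zero w′∈))
    where
    ≡zero : ∀ {w} → w ∈ base → recolor row v zero w ≡ zero
    ≡zero {w} w∈ = by-cases (w ≟ v)
      where
      by-cases : Dec (w ≡ v) → recolor row v zero w ≡ zero
      by-cases (yes refl) = recolor-same row v zero
      by-cases (no w≢v)   = trans (recolor-other row v zero w≢v) (Equivalence.to (∈-graph _) w∈)

  recolor-cross-monochromatic : ∀ {v} i → v ∈ base → Monochromatic (recolor row v (suc i)) (cross i (col v))
  recolor-cross-monochromatic {v} i v∈ w∈ w′∈ = trans (≡suc w∈) (sym (≡suc w′∈))
    where
    σ : Fin r → Fin k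
    σ = recolor (λ _ → suc i) (col v) zero
    ≡suc : ∀ {w} → w ∈ cross i (col v) → recolor row v (suc i) w ≡ suc i
    ≡suc {w} w∈ = by-cases (w ≟ v)
      where
      by-cases : Dec (w ≡ v) → recolor row v (suc i) w ≡ suc i
      by-cases (yes refl) = recolor-same row v (suc i)
      by-cases (no w≢v)   = trans (recolor-other row v (suc i) w≢v)
        (trans (Equivalence.to (∈-graph σ) w∈) (recolor-other (λ _ → suc i) (col v) zero col≢))
        where
        col≢ : col w ≢ col v
        col≢ cw≡cv = w≢v (row-col-injective (begin
          row w      ≡⟨ Equivalence.to (∈-graph σ) w∈ ⟩
          σ (col w)  ≡⟨ cong σ cw≡cv ⟩
          σ (col v)  ≡⟨ recolor-same (λ _ → suc i) (col v) zero ⟩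
          zero       ≡⟨ Equivalence.to (∈-graph _) v∈ ⟨
          row v      ∎) cw≡cv)
          where open ≡-Reasoning

  utility-row : ∀ v → utility H row v ≡ ∑[ t < L ] ⟦ v ∈? crossAt t ⟧
  utility-row v = trans (utility-split row v) (cong₂ _+_
    (trans (cong (⟦ v ∈? base ⟧ *_) ⟦row-base⟧≡0) (*-zeroʳ ⟦ v ∈? base ⟧))
    (sum-cong-≗ λ t →
      trans (cong (⟦ v ∈? crossAt t ⟧ *_) (⟦row-cross⟧≡1 t)) (*-identityʳ ⟦ v ∈? crossAt t ⟧)))

  -- A deviation of v can only make base non-monochromatic if v lies in it and takes a colour
  -- 1 + i; but then the edge cross i (col v) at v becomes monochromatic.
  row-isNash : IsNash H row
  row-isNash v x = begin
    utility H (recolor row v x) v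
      ≡⟨ utility-split (recolor row v x) v ⟩
    ⟦ v ∈? base ⟧ * ⟦ nonMonochromatic? (recolor row v x) base ⟧ + deviation x
      ≤⟨ ⟦⟧*⟦⟧+-≤ (v ∈? base) (nonMonochromatic? (recolor row v x) base) (deviation≤ x)
                   (λ v∈ nm → deviation< x v∈ (≢zero v∈ nm)) ⟩
    ∑[ t < L ] ⟦ v ∈? crossAt t ⟧
      ≡⟨ utility-row v ⟨
    utility H row v ∎
    where
    open ≤-Reasoning
    deviation : Fin k → ℕ
    deviation y = ∑[ t < L ] (⟦ v ∈? crossAt t ⟧ * ⟦ nonMonochromatic? (recolor row v y) (crossAt t) ⟧)
    ≤⟦∈⟧ : ∀ y t →
      ⟦ v ∈? crossAt t ⟧ * ⟦ nonMonochromatic? (recolor row v y) (crossAt t) ⟧ ≤ ⟦ v ∈? crossAt t ⟧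
    ≤⟦∈⟧ y t =
      ≤-trans (*-monoʳ-≤ ⟦ v ∈? crossAt t ⟧ (⟦⟧≤1 (nonMonochromatic? (recolor row v y) (crossAt t))))
              (≤-reflexive (*-identityʳ ⟦ v ∈? crossAt t ⟧))
    deviation≤ : ∀ y → deviation y ≤ ∑[ t < L ] ⟦ v ∈? crossAt t ⟧
    deviation≤ y = ∑-mono-≤ (≤⟦∈⟧ y)
    ≢zero : v ∈ base → NonMonochromatic (recolor row v x) base → x ≢ zero
    ≢zero v∈ nm refl = nonMonochromatic⇒¬monochromatic (recolor row v zero) base nm (recolor-base-monochromatic v∈)
    deviation< : ∀ y → v ∈ base → y ≢ zero → deviation y < ∑[ t < L ] ⟦ v ∈? crossAt t ⟧
    deviation< zero    _  0≢0 = ⊥-elim (0≢0 refl)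
    deviation< (suc i) v∈ _   =
      ∑-mono-< {g = λ t → ⟦ v ∈? crossAt t ⟧} (≤⟦∈⟧ (suc i)) (combine i (col v))
      (subst (λ e → ⟦ v ∈? e ⟧ * ⟦ nonMonochromatic? (recolor row v (suc i)) e ⟧ < ⟦ v ∈? e ⟧)
        (sym (crossAt-combine i (col v)))
        (subst₂ (λ a b → a * b < a)
          (sym (⟦⟧-yes (v ∈? cross i (col v)) (∈base⇒∈cross i v∈)))
          (sym (⟦⟧-no (nonMonochromatic? (recolor row v (suc i)) (cross i (col v)))
                      (λ nm → nonMonochromatic⇒¬monochromatic _ _ nm (recolor-cross-monochromatic i v∈))))
          (s≤s z≤n)))

r*L*[L+1]≡r*[1+L]*L : ∀ r L → r * L * (L + 1) ≡ r * suc L * L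
r*L*[L+1]≡r*[1+L]*L = solve 2 (λ r L → r :* L :* (L :+ con 1) := r :* (con 1 :+ L) :* L) refl

tight-instance : ∀ {k r} → 2 ≤ k → 3 ≤ r → ∃₂ λ n (H : Hypergraph n) →
  IsHypergraph H × RMinimal r H × NE H k ≢ 0 × NE H k * ((k ∸ 1) * r + 1) ≤ Opt H k * ((k ∸ 1) * r)
tight-instance {k@(suc (suc k₀))} {r@(suc (suc (suc r₀)))} (s≤s (s≤s z≤n)) (s≤s (s≤s (s≤s z≤n))) =
  k * r , H , isHypergraph , r-minimal , NE≢0 , ratio
  where
  open Construction k₀ (suc r₀) hiding (k; r; L)
  r-minimal : RMinimal r H
  r-minimal = All.map (λ ∣e∣≡r → ≤-reflexive (sym ∣e∣≡r)) ∣H∣≡r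
  isHypergraph : IsHypergraph H
  isHypergraph = All.map (λ ∣e∣≡r → subst (1 ≤_) (sym ∣e∣≡r) (s≤s z≤n)) ∣H∣≡r
  NE≤ : NE H k ≤ r * ((k ∸ 1) * r)
  NE≤ = subst (NE H k ≤_) SW-row (NE≤SW H k row row-isNash)
  ≤Opt : r * suc ((k ∸ 1) * r) ≤ Opt H k
  ≤Opt = subst (_≤ Opt H k) SW-twisted (SW≤Opt H k twistedColoring)
  NE≢0 : NE H k ≢ 0
  NE≢0 NE≡0 = let c , nash , NE≡ = NE-attained H k row row-isNash in
    contradiction
      (subst₂ (λ a b → a * ((k ∸ 1) * r) ≤ b * ((k ∸ 1) * r + 1)) SW-twisted (trans (sym NE≡) NE≡0)
        (WelfareBound.SW*d≤SW*[d+1] H (s≤s (s≤s (s≤s z≤n))) r-minimal c nash twistedColoring))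
      λ ()
  ratio : NE H k * ((k ∸ 1) * r + 1) ≤ Opt H k * ((k ∸ 1) * r)
  ratio = begin
    NE H k * ((k ∸ 1) * r + 1)             ≤⟨ *-monoˡ-≤ ((k ∸ 1) * r + 1) NE≤ ⟩
    r * ((k ∸ 1) * r) * ((k ∸ 1) * r + 1)  ≡⟨ r*L*[L+1]≡r*[1+L]*L r ((k ∸ 1) * r) ⟩
    r * suc ((k ∸ 1) * r) * ((k ∸ 1) * r)  ≤⟨ *-monoˡ-≤ ((k ∸ 1) * r) ≤Opt ⟩
    Opt H k * ((k ∸ 1) * r)                ∎
    where open ≤-Reasoning

frac-mono : ∀ a b m d → a * suc d ≤ b * suc m → frac a (suc m) ≤ℚ frac b (suc d)
frac-mono a b m d a*d≤b*m = ℚₚ.toℚᵘ-cancel-≤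
  (≤-respˡ-≃ (≃-sym (ℚₚ.toℚᵘ-fromℚᵘ (mkℚᵘ (ℤ.+ a) m)))
  (≤-respʳ-≃ (≃-sym (ℚₚ.toℚᵘ-fromℚᵘ (mkℚᵘ (ℤ.+ b) d)))
  (*≤* (subst₂ ℤ._≤_ (pos-* a (suc d)) (pos-* b (suc m)) (ℤ.+≤+ a*d≤b*m)))))

1+frac≡frac : ∀ d → 1ℚ +ℚ frac 1 (suc d) ≡ frac (suc d + 1) (suc d)
1+frac≡frac d = ℚₚ.toℚᵘ-injective (≃-trans (ℚₚ.toℚᵘ-homo-+ 1ℚ (frac 1 (suc d)))
  (≃-trans (+-cong (≃-refl {mkℚᵘ (ℤ.+ 1) 0}) (ℚₚ.toℚᵘ-fromℚᵘ (mkℚᵘ (ℤ.+ 1) d)))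
  (≃-trans (*≡* (cong ℤ.+_ (trans (cong (λ t → (t + 1) * suc d) (*-identityˡ (suc d)))
                                  (cong ((suc d + 1) *_) (sym (*-identityˡ (suc d)))))))
           (≃-sym (ℚₚ.toℚᵘ-fromℚᵘ (mkℚᵘ (ℤ.+ (suc d + 1)) d))))))

frac≤1+1/d : ∀ a N d → N ≢ 0 → 0 < d → a * d ≤ N * (d + 1) → frac a N ≤ℚ 1ℚ +ℚ frac 1 d
frac≤1+1/d a zero    d       N≢0 _ _ = ⊥-elim (N≢0 refl)
frac≤1+1/d a (suc m) (suc d) _   _ a*d≤N*[d+1] = subst (frac a (suc m) ≤ℚ_) (sym (1+frac≡frac d))
  (frac-mono a (suc d + 1) m d (subst (a * suc d ≤_) (*-comm (suc m) _) a*d≤N*[d+1]))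

1+1/d≤frac : ∀ a N d → N ≢ 0 → 0 < d → N * (d + 1) ≤ a * d → 1ℚ +ℚ frac 1 d ≤ℚ frac a N
1+1/d≤frac a zero    d       N≢0 _ _ = ⊥-elim (N≢0 refl)
1+1/d≤frac a (suc m) (suc d) _   _ N*[d+1]≤a*d = subst (_≤ℚ frac a (suc m)) (sym (1+frac≡frac d))
  (frac-mono (suc d + 1) a d m (subst (_≤ a * suc d) (*-comm (suc m) _) N*[d+1]≤a*d))

-ε< : ∀ {p q ε} → 0ℚ <ℚ ε → p ≤ℚ q → p -ℚ ε <ℚ q
-ε< {p} 0<ε p≤q =
  ℚₚ.<-≤-trans (ℚₚ.<-respʳ-≡ (ℚₚ.+-identityʳ p) (ℚₚ.+-monoʳ-< p (ℚₚ.neg-antimono-< 0<ε))) p≤q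

theorem1 : (r k : ℕ) → 3 ≤ r → 2 ≤ k →
    ((n : ℕ) (H : Hypergraph n) → IsHypergraph H → RMinimal r H → NE H k ≢ 0 →
      frac (Opt H k) (NE H k) ≤ℚ 1ℚ +ℚ frac 1 ((k ∸ 1) * r))
    × ((ε : ℚ) → 0ℚ <ℚ ε →
      Σ ℕ (λ n → Σ (Hypergraph n) (λ H → IsHypergraph H × RMinimal r H × NE H k ≢ 0 ×
        (1ℚ +ℚ frac 1 ((k ∸ 1) * r)) -ℚ ε <ℚ frac (Opt H k) (NE H k))))
theorem1 r k 3≤r 2≤k =
  (λ n H _ r-minimal NE≢0 →
    frac≤1+1/d (Opt H k) (NE H k) _ NE≢0 0<d (Opt*d≤NE*[d+1] k H 3≤r r-minimal NE≢0)) ,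
  (λ ε 0<ε → let n , H , isHypergraph , r-minimal , NE≢0 , ratio = tight-instance 2≤k 3≤r in
    n , H , isHypergraph , r-minimal , NE≢0 , -ε< 0<ε (1+1/d≤frac (Opt H k) (NE H k) _ NE≢0 0<d ratio))
  where
  0<d : 0 < (k ∸ 1) * r
  0<d = *-mono-≤ (∸-monoˡ-≤ 1 2≤k) (≤-trans (s≤s z≤n) 3≤r)
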